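{- Let $n\ge1$ and $(\alpha_n,\beta_n)=R_n\circ\cdots\circ R_1(a,ab)$ for some $R_1,\dots,R_n\in\{\widetilde{U},\widetilde{V}\}$. Then one can write $\alpha_n=a\theta b$ and $\beta_n=a\theta'b$ where $\theta,\theta'$ are palindromes (words over $\{a,b\}$ equal to their reversal), and $\theta$ is both a prefix and a suffix of $\theta'$.
   Context: $\widetilde{U}(\alpha,\beta)=(\alpha\beta\beta,\alpha\beta\beta\beta)$ and $\widetilde{V}(\alpha,\beta)=(\alpha\beta\beta\beta,\alpha\beta\beta\beta\beta)$ act on pairs of words over $\{a,b\}$; $R_1$ is applied first. -}

module Defs where

open import Data.List using (List; []; _∷_; _++_; reverse; foldl)
open import Data.Product using (_×_; _,_; ∃-syntax)
open import Relation.Binary.PropositionalEquality using (_≡_)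

data Letter : Set where
  a b : Letter

Word : Set
Word = List Letter

Palindrome : Word → Set
Palindrome w = reverse w ≡ w

IsPrefix : Word → Word → Set
IsPrefix u w = ∃[ v ] (u ++ v ≡ w)

IsSuffix : Word → Word → Set
IsSuffix u w = ∃[ v ] (v ++ u ≡ w)

data Map : Set where
  U V : Map

apply : Map → Word × Word → Word × Word
apply U (α , β) = (α ++ β ++ β , α ++ β ++ β ++ β)
apply V (α , β) = (α ++ β ++ β ++ β , α ++ β ++ β ++ β ++ β)

-- applyAll (R₁ ∷ R₂ ∷ … ∷ Rₙ ∷ []) p = Rₙ ∘ ⋯ ∘ R₁ (p)   (R₁ applied first)
applyAll : List Map → Word × Word → Word × Word
applyAll Rs p = foldl (λ q R → apply R q) p Rs

module Submission where

-- Write α = a θ b and β = a θ′ b.  Concatenation of such words is again of this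
-- form, with inner word θ ba θ′, so the maps act on the inner words.  The invariant
-- carried along is θ′ = θ ba y, where θ and y are palindromes with θ ba y = y ab θ:
-- reversing θ ba y gives y ab θ, so θ′ is a palindrome; θ is visibly a prefix of
-- θ′, and by the identity also a suffix.  The invariant survives both maps because
-- the identity for (θ, y) implies it for (θ ba y, y) and for (θ, θ ba y).

open import Defs
open import Data.List using (List; []; _∷_; _++_; length; reverse)
open import Data.List.Properties using (++-assoc; reverse-++)
open import Data.Nat using (_≥_)
open import Data.Product using (_×_; _,_; ∃-syntax)
open import Relation.Binary.PropositionalEquality
  using (_≡_; refl; sym; trans; cong; cong₂; subst; module ≡-Reasoning)
open ≡-Reasoning

infixl 5 _·_ _⋆_

_·_ : Word → Word → Word
x · y = x ++ b ∷ a ∷ y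

_⋆_ : Word → Word → Word
x ⋆ y = x ++ a ∷ b ∷ y

wrap : Word → Word
wrap x = a ∷ x ++ b ∷ []

reverse-· : ∀ x y → reverse (x · y) ≡ reverse y ⋆ reverse x
reverse-· x y = begin
  reverse (x ++ b ∷ a ∷ y)                    ≡⟨ reverse-++ x (b ∷ a ∷ y) ⟩
  reverse (b ∷ a ∷ y) ++ reverse x            ≡⟨ cong (_++ reverse x) (reverse-++ (b ∷ a ∷ []) y) ⟩
  (reverse y ++ a ∷ b ∷ []) ++ reverse x      ≡⟨ ++-assoc (reverse y) (a ∷ b ∷ []) (reverse x) ⟩
  reverse y ⋆ reverse x                       ∎

record PalindromePair (x y : Word) : Set where
  field
    palindromeˡ : Palindrome x
    palindromeʳ : Palindrome y
    swap        : x · y ≡ y ⋆ x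

open PalindromePair

module _ {x y : Word} (p : PalindromePair x y) where

  palindrome-· : Palindrome (x · y)
  palindrome-· = begin
    reverse (x · y)          ≡⟨ reverse-· x y ⟩
    reverse y ⋆ reverse x    ≡⟨ cong₂ _⋆_ (palindromeʳ p) (palindromeˡ p) ⟩
    y ⋆ x                    ≡⟨ sym (swap p) ⟩
    x · y                    ∎

  pair-·ˡ : PalindromePair (x · y) y
  pair-·ˡ = record
    { palindromeˡ = palindrome-·
    ; palindromeʳ = palindromeʳ p
    ; swap        = trans (cong (_· y) (swap p)) (++-assoc y (a ∷ b ∷ x) (b ∷ a ∷ y))
    }

  pair-·ʳ : PalindromePair x (x · y)
  pair-·ʳ = record
    { palindromeˡ = palindromeˡ p
    ; palindromeʳ = palindrome-·
    ; swap        = trans (cong (x ·_) (swap p)) (sym (++-assoc x (b ∷ a ∷ y) (a ∷ b ∷ x)))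
    }

  prefix-· : IsPrefix x (x · y)
  prefix-· = b ∷ a ∷ y , refl

  suffix-· : IsSuffix x (x · y)
  suffix-· = y ++ a ∷ b ∷ [] , trans (++-assoc y (a ∷ b ∷ []) x) (sym (swap p))

wrap-· : ∀ x y → wrap x ++ wrap y ≡ wrap (x · y)
wrap-· x y = cong (a ∷_) (begin
  (x ++ b ∷ []) ++ a ∷ y ++ b ∷ []   ≡⟨ ++-assoc x (b ∷ []) (a ∷ y ++ b ∷ []) ⟩
  x ++ b ∷ a ∷ y ++ b ∷ []           ≡⟨ sym (++-assoc x (b ∷ a ∷ y) (b ∷ [])) ⟩
  (x · y) ++ b ∷ []                  ∎)

wrap-·-++ : ∀ x y w → wrap x ++ wrap y ++ w ≡ wrap (x · y) ++ w
wrap-·-++ x y w = trans (sym (++-assoc (wrap x) (wrap y) w)) (cong (_++ w) (wrap-· x y))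

grow : Map → Word → Word → Word
grow U x y = x · y · y
grow V x y = x · y · y · y

apply-wrap : ∀ R x y → apply R (wrap x , wrap y) ≡ (wrap (grow R x y) , wrap (grow R x y · y))
apply-wrap U x y = cong₂ _,_
  (trans (wrap-·-++ x y _) (wrap-· (x · y) y))
  (trans (wrap-·-++ x y _) (trans (wrap-·-++ (x · y) y _) (wrap-· (x · y · y) y)))
apply-wrap V x y = cong₂ _,_
  (trans (wrap-·-++ x y _) (trans (wrap-·-++ (x · y) y _) (wrap-· (x · y · y) y)))
  (trans (wrap-·-++ x y _) (trans (wrap-·-++ (x · y) y _)
    (trans (wrap-·-++ (x · y · y) y _) (wrap-· (x · y · y · y) y))))

pair-grow : ∀ R {x y} → PalindromePair x y → PalindromePair (grow R x y) y
pair-grow U p = pair-·ˡ (pair-·ˡ p)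
pair-grow V p = pair-·ˡ (pair-·ˡ (pair-·ˡ p))

data Standard : Word × Word → Set where
  standard : ∀ {x y} → PalindromePair x y → Standard (wrap x , wrap (x · y))

apply-standard : ∀ R {p} → Standard p → Standard (apply R p)
apply-standard R (standard {x} {y} p) =
  subst Standard (sym (apply-wrap R x (x · y))) (standard (pair-grow R (pair-·ʳ p)))

applyAll-standard : ∀ Rs {p} → Standard p → Standard (applyAll Rs p)
applyAll-standard []       s = s
applyAll-standard (R ∷ Rs) s = applyAll-standard Rs (apply-standard R s)

-- The very first step leaves (a , ab), which is not of the form (wrap x , wrap _).
apply-initial-standard : ∀ R → Standard (apply R (a ∷ [] , a ∷ b ∷ []))
apply-initial-standard U =
  standard {a ∷ b ∷ a ∷ []} {[]} record { palindromeˡ = refl ; palindromeʳ = refl ; swap = refl }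
apply-initial-standard V =
  standard {a ∷ b ∷ a ∷ b ∷ a ∷ []} {[]} record { palindromeˡ = refl ; palindromeʳ = refl ; swap = refl }

standard-shape : ∀ {p} → Standard p →
  ∃[ θ ] ∃[ θ′ ] (p ≡ (wrap θ , wrap θ′)
    × Palindrome θ × Palindrome θ′ × IsPrefix θ θ′ × IsSuffix θ θ′)
standard-shape (standard {θ} {y} p) =
  θ , θ · y , refl , palindromeˡ p , palindrome-· p , prefix-· p , suffix-· p

lemma3p4 : (Rs : List Map) → length Rs ≥ 1 →
    ∃[ θ ] ∃[ θ′ ]
      (applyAll Rs (a ∷ [] , a ∷ b ∷ []) ≡ (a ∷ θ ++ b ∷ [] , a ∷ θ′ ++ b ∷ [])
       × Palindrome θ × Palindrome θ′ × IsPrefix θ θ′ × IsSuffix θ θ′)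
lemma3p4 (R ∷ Rs) _ = standard-shape (applyAll-standard Rs (apply-initial-standard R))
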